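{- Let $n\ge1$, $H=\{x\in\mathbb{F}_{2^n}:\mathrm{Tr}(x)=0\}$, and let $Q|_H$ be the restriction to $H$ of the quadratic form $Q(x)=\sum_{0\le i<j<n}x^{2^i+2^j}$. Then $\mathrm{rad}(Q|_H)=\{0,1\}$ if $n\equiv 0\pmod 4$, and $\mathrm{rad}(Q|_H)=\{0\}$ otherwise.
   Context: $\mathrm{Tr}$ is the absolute trace $\mathbb{F}_{2^n}\to\mathbb{F}_2$; $Q$ takes values in $\mathbb{F}_2$. For a quadratic form $f\colon V\to\mathbb{F}_2$ on an $\mathbb{F}_2$-vector space $V$, its associated bilinear form is $B_f(x,y)=f(x)+f(y)+f(x+y)$, the radical of a bilinear form $B$ is $\mathrm{rad}(B)=\{y\in V: B(x,y)=0\ \forall x\in V\}$, and the radical of $f$ is $\mathrm{rad}(f)=\mathrm{rad}(B_f)\cap f^{ -1}(\{0\})$. Here $V=H$ and $f=Q|_H$. -}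

module Defs where

open import Level using (Level; _⊔_)
open import Algebra.Bundles using (CommutativeRing)
open import Data.Nat as ℕ using (ℕ; zero; suc)
open import Data.Fin using (Fin)
open import Data.Product using (_×_; ∃)
open import Relation.Nullary using (¬_)
open import Relation.Binary.PropositionalEquality using (_≡_)

record FiniteField2 (n : ℕ) (c ℓ : Level) : Set (Level.suc (c ⊔ ℓ)) where
  field
    commRing : CommutativeRing c ℓ
  open CommutativeRing commRing public
  field
    0≉1   : ¬ (0# ≈ 1#)
    inv   : ∀ x → ¬ (x ≈ 0#) → ∃ λ y → (x * y) ≈ 1#
    toFin   : Carrier → Fin (2 ℕ.^ n)
    fromFin : Fin (2 ℕ.^ n) → Carrier
    toFin-cong : ∀ {x y} → x ≈ y → toFin x ≡ toFin y
    from∘to : ∀ x → fromFin (toFin x) ≈ x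
    to∘from : ∀ i → toFin (fromFin i) ≡ i

module FieldOps {n : ℕ} {c ℓ : Level} (K : FiniteField2 n c ℓ) where
  open FiniteField2 K

  pow : Carrier → ℕ → Carrier
  pow x zero    = 1#
  pow x (suc k) = x * pow x k

  sumTo : ℕ → (ℕ → Carrier) → Carrier
  sumTo zero    f = 0#
  sumTo (suc m) f = sumTo m f + f m

  Tr : Carrier → Carrier
  Tr x = sumTo n (λ i → pow x (2 ℕ.^ i))

  InH : Carrier → Set ℓ
  InH x = Tr x ≈ 0#

  Q : Carrier → Carrier
  Q x = sumTo n (λ j → sumTo j (λ i → pow x (2 ℕ.^ i ℕ.+ 2 ℕ.^ j)))

  BQ : Carrier → Carrier → Carrier
  BQ x y = Q x + Q y + Q (x + y)

  InRadQH : Carrier → Set (c ⊔ ℓ)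
  InRadQH y = InH y × ((x : Carrier) → InH x → BQ x y ≈ 0#) × (Q y ≈ 0#)

module Submission where

-- All facts about the finite field K come from its enumeration K ≅ Fin (2^n):
-- reindexing a sum over K (in any commutative monoid) along a bijection of K gives
-- characteristic two (translate by 1) and Frobenius x^(2^n) = x (scale by x ≠ 0).
-- Then x ↦ x^(2^i) is additive, so Tr is additive with values in {0,1}, and a root
-- bound for polynomials (module Polynomial, over any commutative ring) shows that
-- Tr, of degree 2^(n-1) < 2^n, takes the value 1.  Polarizing the second elementary
-- symmetric sum gives  B_Q(x,y) = Tr x · Tr y + Tr (x y),  so y ∈ rad(Q|_H) forces
-- Tr (x y) = 0 for x ∈ H; with Tr w = 1 and t = Tr (w y) ∈ {0,1} this yields
-- Tr (x (y + t)) = 0 for all x, and nondegeneracy of the trace form gives y = t.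
-- Finally 0 always lies in the radical, and 1 does iff Tr 1 = n·1 and
-- Q 1 = (n choose 2)·1 vanish in K, i.e. iff 4 ∣ n.

open import Defs
open import Level using (Level)
open import Algebra.Bundles using (CommutativeRing; CommutativeMonoid)
open import Data.Nat as ℕ using (ℕ; zero; suc; _≤_; z≤n; s≤s)
import Data.Nat.Properties as ℕP
open import Data.Nat.Divisibility using (_∣_; divides; ∣-refl; ∣m∣n⇒∣m+n)
open import Data.Fin as Fin using (Fin)
import Data.Fin.Properties as FinP
open import Data.Fin.Permutation using (permutation)
open import Data.List using (List; []; _∷_; length)
open import Data.Sum using (_⊎_; inj₁; inj₂; [_,_]′) renaming (map to map-⊎)
open import Data.Product using (_×_; _,_; ∃; proj₁; proj₂)
open import Data.Empty using (⊥-elim)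
open import Function.Base using (_∘_)
open import Function.Bundles using (_⇔_; mk⇔)
open import Relation.Nullary using (¬_; Dec; yes; no)
open import Relation.Binary.PropositionalEquality as ≡ using (_≡_; _≢_)
import Algebra.Properties.CommutativeMonoid.Sum as MonoidSum
import Algebra.Properties.Group as GroupProperties
import Algebra.Properties.CommutativeSemigroup as CommSemigroupProperties
import Algebra.Properties.Semiring.Mult as SemiringMult
import Algebra.Solver.Ring.NaturalCoefficients.Default as Solver

-- Polynomials over a commutative ring as coefficient lists, constant term first.
module Polynomial {c ℓ : Level} (R : CommutativeRing c ℓ) where
  open CommutativeRing R
  open GroupProperties +-group using (x∙y⁻¹≈ε⇒x≈y)
  open import Relation.Binary.Reasoning.Setoid setoid
  open Solver commutativeSemiring using (solve; _:=_; _:+_; _:*_)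

  eval : List Carrier → Carrier → Carrier
  eval []       x = 0#
  eval (a ∷ as) x = a + x * eval as x

  eval-constant : ∀ a x → eval (a ∷ []) x ≈ a
  eval-constant a x = trans (+-congˡ (zeroʳ x)) (+-identityʳ a)

  lastOr : Carrier → List Carrier → Carrier
  lastOr d []       = d
  lastOr d (a ∷ as) = lastOr a as

  leading : List Carrier → Carrier
  leading = lastOr 0#

  -- Synthetic division by X - r: the coefficient of X^j in the quotient of
  -- a₀ + a₁X + ... is  a_{j+1} + a_{j+2} r + a_{j+3} r² + ...
  quotient : Carrier → List Carrier → List Carrier
  quotient r []           = []
  quotient r (a ∷ [])     = []
  quotient r (a ∷ b ∷ bs) = eval (b ∷ bs) r ∷ quotient r (b ∷ bs)

  division : ∀ r as x → eval as x ≈ eval as r + (x - r) * eval (quotient r as) x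
  division r [] x = sym (trans (+-congˡ (zeroʳ _)) (+-identityʳ 0#))
  division r (a ∷ []) x = begin
    eval (a ∷ []) x                   ≈⟨ eval-constant a x ⟩
    a                                 ≈⟨ sym (+-identityʳ a) ⟩
    a + 0#                            ≈⟨ +-cong (sym (eval-constant a r)) (sym (zeroʳ _)) ⟩
    eval (a ∷ []) r + (x - r) * 0#    ∎
  division r (a ∷ b ∷ bs) x = begin
    a + x * P x                              ≈⟨ +-congˡ (*-congˡ (division r (b ∷ bs) x)) ⟩
    a + x * (P r + (x - r) * D)              ≈⟨ sym (+-identityʳ _) ⟩
    a + x * (P r + (x - r) * D) + 0#         ≈⟨ +-congˡ (sym (trans (*-congʳ (-‿inverseʳ r)) (zeroˡ (P r)))) ⟩
    a + x * (P r + (x - r) * D) + (r - r) * P r  ≈⟨ regroup a x r (- r) (P r) D ⟩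
    (a + r * P r) + (x - r) * (P r + x * D)  ∎
    where
    P : Carrier → Carrier
    P = eval (b ∷ bs)
    D : Carrier
    D = eval (quotient r (b ∷ bs)) x
    regroup : ∀ a x r s p d →
              a + x * (p + (x + s) * d) + (r + s) * p ≈ (a + r * p) + (x + s) * (p + x * d)
    regroup = solve 6 (λ a x r s p d →
      a :+ x :* (p :+ (x :+ s) :* d) :+ (r :+ s) :* p := (a :+ r :* p) :+ (x :+ s) :* (p :+ x :* d)) refl

  length-quotient : ∀ r a as → length (quotient r (a ∷ as)) ≡ length as
  length-quotient r a []       = ≡.refl
  length-quotient r a (b ∷ bs) = ≡.cong suc (length-quotient r b bs)

  lastOr-quotient : ∀ r a b bs d → lastOr d (quotient r (a ∷ b ∷ bs)) ≈ lastOr b bs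
  lastOr-quotient r a b []        d = eval-constant b r
  lastOr-quotient r a b (b′ ∷ bs) d = lastOr-quotient r b b′ bs (eval (b ∷ b′ ∷ bs) r)

  module RootBound (no-zero-divisors : ∀ {x y} → x * y ≈ 0# → x ≈ 0# ⊎ y ≈ 0#) where

    root-bound : ∀ k (pt : Fin k → Carrier) → (∀ i j → pt i ≈ pt j → i ≡ j) →
                 ∀ as → length as ≤ k → ¬ (leading as ≈ 0#) → ¬ (∀ i → eval as (pt i) ≈ 0#)
    root-bound k pt pt-injective [] _ lead≉0 _ = lead≉0 refl
    root-bound (suc k) pt pt-injective (a ∷ []) _ lead≉0 roots =
      lead≉0 (trans (sym (eval-constant a (pt Fin.zero))) (roots Fin.zero))
    root-bound (suc k) pt pt-injective (a ∷ b ∷ bs) (s≤s len) lead≉0 roots =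
      root-bound k (pt ∘ Fin.suc) (λ i j e → FinP.suc-injective (pt-injective _ _ e))
        (quotient r (a ∷ b ∷ bs))
        (ℕP.≤-trans (ℕP.≤-reflexive (length-quotient r a (b ∷ bs))) len)
        (λ e → lead≉0 (trans (sym (lastOr-quotient r a b bs 0#)) e))
        quotient-roots
      where
      r : Carrier
      r = pt Fin.zero
      q : List Carrier
      q = quotient r (a ∷ b ∷ bs)
      factored : ∀ x → eval (a ∷ b ∷ bs) x ≈ 0# → (x - r) * eval q x ≈ 0#
      factored x root = begin
        (x - r) * eval q x                       ≈⟨ sym (+-identityˡ _) ⟩
        0# + (x - r) * eval q x                  ≈⟨ +-congʳ (sym (roots Fin.zero)) ⟩
        eval (a ∷ b ∷ bs) r + (x - r) * eval q x ≈⟨ sym (division r (a ∷ b ∷ bs) x) ⟩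
        eval (a ∷ b ∷ bs) x                      ≈⟨ root ⟩
        0#                                       ∎
      quotient-roots : ∀ i → eval q (pt (Fin.suc i)) ≈ 0#
      quotient-roots i with no-zero-divisors (factored _ (roots (Fin.suc i)))
      ... | inj₁ x-r≈0 = ⊥-elim (FinP.0≢1+n (pt-injective _ _ (sym (x∙y⁻¹≈ε⇒x≈y _ _ x-r≈0))))
      ... | inj₂ q≈0   = q≈0

module FiniteFieldTheory {c ℓ : Level} {n : ℕ} (K : FiniteField2 n c ℓ) where
  open FiniteField2 K
  open FieldOps K
  open GroupProperties +-group using (∙-cancelʳ; identityʳ-unique; inverseˡ-unique; inverseʳ-unique)
  open SemiringMult semiring using (×1-homo-*) renaming (_×_ to _×ᴷ_)
  open CommSemigroupProperties *-commutativeSemigroup using () renaming (interchange to *-interchange)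
  open CommSemigroupProperties +-commutativeSemigroup using ()
    renaming (interchange to +-interchange; xy∙z≈xz∙y to +-swapʳ)
  open import Relation.Binary.Reasoning.Setoid setoid
  open Solver commutativeSemiring using (solve; _:=_; _:+_; _:*_)
  module Sum  = MonoidSum +-commutativeMonoid
  module Prod = MonoidSum *-commutativeMonoid

  N : ℕ
  N = 2 ℕ.^ n

  _≟_ : (x y : Carrier) → Dec (x ≈ y)
  x ≟ y with toFin x Fin.≟ toFin y
  ... | yes e = yes (trans (sym (from∘to x)) (trans (reflexive (≡.cong fromFin e)) (from∘to y)))
  ... | no ne = no (ne ∘ toFin-cong)

  toFin-of : ∀ {x} i → x ≈ fromFin i → toFin x ≡ i
  toFin-of i e = ≡.trans (toFin-cong e) (to∘from i)

  fromFin-injective : ∀ i j → fromFin i ≈ fromFin j → i ≡ j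
  fromFin-injective i j e = ≡.trans (≡.sym (to∘from i)) (toFin-of j e)

  no-zero-divisors : ∀ {x y} → x * y ≈ 0# → x ≈ 0# ⊎ y ≈ 0#
  no-zero-divisors {x} {y} xy≈0 with x ≟ 0#
  ... | yes x≈0 = inj₁ x≈0
  ... | no x≉0 = inj₂ (begin
    y                ≈⟨ sym (*-identityˡ y) ⟩
    1# * y           ≈⟨ *-congʳ (sym (trans (*-comm _ x) x⁻¹-inverse)) ⟩
    (x⁻¹ * x) * y    ≈⟨ *-assoc x⁻¹ x y ⟩
    x⁻¹ * (x * y)    ≈⟨ *-congˡ xy≈0 ⟩
    x⁻¹ * 0#         ≈⟨ zeroʳ x⁻¹ ⟩
    0#               ∎)
    where
    x⁻¹ : Carrier
    x⁻¹ = proj₁ (inv x x≉0)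
    x⁻¹-inverse : x * x⁻¹ ≈ 1#
    x⁻¹-inverse = proj₂ (inv x x≉0)

  *-cancelʳ-nonzero : ∀ {x y z} → ¬ (z ≈ 0#) → x * z ≈ y * z → x ≈ y
  *-cancelʳ-nonzero {x} {y} {z} z≉0 e = begin
    x                ≈⟨ sym (*-identityʳ x) ⟩
    x * 1#           ≈⟨ *-congˡ (sym z⁻¹-inverse) ⟩
    x * (z * z⁻¹)    ≈⟨ sym (*-assoc x z z⁻¹) ⟩
    (x * z) * z⁻¹    ≈⟨ *-congʳ e ⟩
    (y * z) * z⁻¹    ≈⟨ *-assoc y z z⁻¹ ⟩
    y * (z * z⁻¹)    ≈⟨ *-congˡ z⁻¹-inverse ⟩
    y * 1#           ≈⟨ *-identityʳ y ⟩
    y                ∎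
    where
    z⁻¹ : Carrier
    z⁻¹ = proj₁ (inv z z≉0)
    z⁻¹-inverse : z * z⁻¹ ≈ 1#
    z⁻¹-inverse = proj₂ (inv z z≉0)

  idempotent-0or1 : ∀ t → t * t ≈ t → t ≈ 0# ⊎ t ≈ 1#
  idempotent-0or1 t tt≈t with t ≟ 0#
  ... | yes t≈0 = inj₁ t≈0
  ... | no t≉0 = inj₂ (*-cancelʳ-nonzero t≉0 (trans tt≈t (sym (*-identityˡ t))))

  pow-cong : ∀ {x y} k → x ≈ y → pow x k ≈ pow y k
  pow-cong zero    e = refl
  pow-cong (suc k) e = *-cong e (pow-cong k e)

  pow-+ : ∀ x a b → pow x (a ℕ.+ b) ≈ pow x a * pow x b
  pow-+ x zero    b = sym (*-identityˡ _)
  pow-+ x (suc a) b = trans (*-congˡ (pow-+ x a b)) (sym (*-assoc _ _ _))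

  pow-* : ∀ x y k → pow (x * y) k ≈ pow x k * pow y k
  pow-* x y zero    = sym (*-identityˡ 1#)
  pow-* x y (suc k) = trans (*-congˡ (pow-* x y k)) (*-interchange x y (pow x k) (pow y k))

  pow-one : ∀ k → pow 1# k ≈ 1#
  pow-one zero    = refl
  pow-one (suc k) = trans (*-identityˡ _) (pow-one k)

  pow-of-zero : ∀ {x} k → x ≈ 0# → 1 ≤ k → pow x k ≈ 0#
  pow-of-zero (suc k) x≈0 _ = trans (*-congʳ x≈0) (zeroˡ _)

  pow≈0⇒≈0 : ∀ {x} k → pow x k ≈ 0# → x ≈ 0#
  pow≈0⇒≈0 zero    1≈0 = ⊥-elim (0≉1 (sym 1≈0))
  pow≈0⇒≈0 (suc k) e with no-zero-divisors e
  ... | inj₁ x≈0 = x≈0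
  ... | inj₂ p≈0 = pow≈0⇒≈0 k p≈0

  sumOverField : ∀ {a b} (M : CommutativeMonoid a b) →
                 (Carrier → CommutativeMonoid.Carrier M) → CommutativeMonoid.Carrier M
  sumOverField M F = MonoidSum.sum M (λ i → F (fromFin i))

  sumOverField-bijection :
    ∀ {a b} (M : CommutativeMonoid a b) (F : Carrier → CommutativeMonoid.Carrier M) →
    (∀ {x y} → x ≈ y → CommutativeMonoid._≈_ M (F x) (F y)) →
    (φ ψ : Carrier → Carrier) → (∀ {x y} → x ≈ y → φ x ≈ φ y) → (∀ {x y} → x ≈ y → ψ x ≈ ψ y) →
    (∀ x → φ (ψ x) ≈ x) → (∀ x → ψ (φ x) ≈ x) →
    CommutativeMonoid._≈_ M (sumOverField M F) (sumOverField M (F ∘ φ))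
  sumOverField-bijection M F F-cong φ ψ φ-cong ψ-cong φψ ψφ =
    M.trans (MΣ.sum-permute (λ i → F (fromFin i)) (permutation τ σ τσ στ))
            (MΣ.sum-cong-≋ {N} {λ i → F (fromFin (τ i))} {λ i → F (φ (fromFin i))}
              (λ i → F-cong (from∘to _)))
    where
    module M = CommutativeMonoid M
    module MΣ = MonoidSum M
    τ σ : Fin N → Fin N
    τ i = toFin (φ (fromFin i))
    σ i = toFin (ψ (fromFin i))
    τσ : ∀ i → τ (σ i) ≡ i
    τσ i = toFin-of i (trans (φ-cong (from∘to _)) (φψ _))
    στ : ∀ i → σ (τ i) ≡ i
    στ i = toFin-of i (trans (ψ-cong (from∘to _)) (ψφ _))

  -- K has characteristic two: translating by 1 shows 2^n · 1 = 0 in K.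
  characteristic-two : 1# + 1# ≈ 0#
  characteristic-two = trans (sym (+-congˡ (+-identityʳ 1#))) (pow≈0⇒≈0 n (begin
    pow (2 ×ᴷ 1#) n  ≈⟨ sym (two-power n) ⟩
    N ×ᴷ 1#          ≈⟨ sym (Sum.sum-replicate N) ⟩
    Sum.sum {N} (λ _ → 1#) ≈⟨ identityʳ-unique S _ (sym translation) ⟩
    0#              ∎))
    where
    S : Carrier
    S = sumOverField +-commutativeMonoid (λ z → z)
    translation : S ≈ S + Sum.sum {N} (λ _ → 1#)
    translation = trans
      (sumOverField-bijection +-commutativeMonoid (λ z → z) (λ e → e) (_+ 1#) (_- 1#)
        +-congʳ +-congʳ
        (λ x → trans (+-assoc x _ _) (trans (+-congˡ (-‿inverseˡ 1#)) (+-identityʳ x)))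
        (λ x → trans (+-assoc x _ _) (trans (+-congˡ (-‿inverseʳ 1#)) (+-identityʳ x))))
      (Sum.∑-distrib-+ fromFin (λ _ → 1#))
    two-power : ∀ k → (2 ℕ.^ k) ×ᴷ 1# ≈ pow (2 ×ᴷ 1#) k
    two-power zero    = +-identityʳ 1#
    two-power (suc k) = trans (×1-homo-* 2 (2 ℕ.^ k)) (*-congˡ (two-power k))

  prod : ∀ {m} → (Fin m → Carrier) → Carrier
  prod = Prod.sum

  ∏-scale : ∀ m a (f : Fin m → Carrier) → prod (λ i → a * f i) ≈ pow a m * prod f
  ∏-scale zero    a f = sym (*-identityˡ 1#)
  ∏-scale (suc m) a f = trans (*-congˡ (∏-scale m a (f ∘ Fin.suc))) (*-interchange a _ _ _)

  ∏-nonzero : ∀ m (f : Fin m → Carrier) → (∀ i → ¬ (f i ≈ 0#)) → ¬ (prod f ≈ 0#)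
  ∏-nonzero zero    f nonzero 1≈0 = 0≉1 (sym 1≈0)
  ∏-nonzero (suc m) f nonzero e with no-zero-divisors e
  ... | inj₁ head≈0 = nonzero Fin.zero head≈0
  ... | inj₂ rest≈0 = ∏-nonzero m (f ∘ Fin.suc) (nonzero ∘ Fin.suc) rest≈0

  ∏-single : ∀ {m} (f : Fin m → Carrier) j → (∀ i → i ≢ j → f i ≈ 1#) → prod f ≈ f j
  ∏-single {suc m} f j others = begin
    prod f                      ≈⟨ Prod.sum-remove {i = j} f ⟩
    f j * prod (f ∘ Fin.punchIn j) ≈⟨ *-congˡ ones ⟩
    f j * 1#                    ≈⟨ *-identityʳ (f j) ⟩
    f j                         ∎
    where
    ones : prod (f ∘ Fin.punchIn j) ≈ 1#
    ones = trans (Prod.sum-cong-≋ {m} {f ∘ Fin.punchIn j} {λ _ → 1#}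
                   (λ i → others _ (FinP.punchInᵢ≢i j i)))
                 (Prod.sum-replicate-zero m)

  -- For x ≠ 0, multiplying every element by x
  -- permutes K; comparing the products of all elements (with 0 replaced by 1)
  -- before and after gives x^(2^n) · P = P · x with P ≠ 0.
  nonzeroPart : Carrier → Carrier
  nonzeroPart z with z ≟ 0#
  ... | yes _ = 1#
  ... | no _  = z

  nonzeroPart-nonzero : ∀ z → ¬ (nonzeroPart z ≈ 0#)
  nonzeroPart-nonzero z with z ≟ 0#
  ... | yes _   = λ 1≈0 → 0≉1 (sym 1≈0)
  ... | no z≉0  = z≉0

  nonzeroPart-cong : ∀ {z w} → z ≈ w → nonzeroPart z ≈ nonzeroPart w
  nonzeroPart-cong {z} {w} e with z ≟ 0# | w ≟ 0#
  ... | yes _   | yes _   = refl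
  ... | yes z≈0 | no w≉0  = ⊥-elim (w≉0 (trans (sym e) z≈0))
  ... | no z≉0  | yes w≈0 = ⊥-elim (z≉0 (trans e w≈0))
  ... | no _    | no _    = e

  -- x at 0, and 1 elsewhere: the defect of z ↦ nonzeroPart z under scaling by x.
  onlyAtZero : Carrier → Carrier → Carrier
  onlyAtZero x z with z ≟ 0#
  ... | yes _ = x
  ... | no _  = 1#

  scale-nonzeroPart : ∀ {x} → ¬ (x ≈ 0#) → ∀ z →
                      x * nonzeroPart z ≈ nonzeroPart (x * z) * onlyAtZero x z
  scale-nonzeroPart {x} x≉0 z with z ≟ 0# | (x * z) ≟ 0#
  ... | yes _   | yes _    = trans (*-identityʳ x) (sym (*-identityˡ x))
  ... | yes z≈0 | no xz≉0  = ⊥-elim (xz≉0 (trans (*-congˡ z≈0) (zeroʳ x)))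
  ... | no z≉0  | yes xz≈0 = ⊥-elim ([ x≉0 , z≉0 ]′ (no-zero-divisors xz≈0))
  ... | no _    | no _     = sym (*-identityʳ _)

  ∏-onlyAtZero : ∀ x → prod (λ i → onlyAtZero x (fromFin i)) ≈ x
  ∏-onlyAtZero x = trans (∏-single _ (toFin 0#) others) at-zero
    where
    at-zero : onlyAtZero x (fromFin (toFin 0#)) ≈ x
    at-zero with fromFin (toFin 0#) ≟ 0#
    ... | yes _ = refl
    ... | no ≉0 = ⊥-elim (≉0 (from∘to 0#))
    others : ∀ i → i ≢ toFin 0# → onlyAtZero x (fromFin i) ≈ 1#
    others i i≢0 with fromFin i ≟ 0#
    ... | yes ≈0 = ⊥-elim (i≢0 (≡.sym (toFin-of i (sym ≈0))))
    ... | no _   = refl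

  frobenius : ∀ x → pow x N ≈ x
  frobenius x with x ≟ 0#
  ... | yes x≈0 = trans (pow-of-zero N x≈0 (ℕP.m^n>0 2 n)) (sym x≈0)
  ... | no x≉0 = *-cancelʳ-nonzero P≉0 (begin
    pow x N * P                                          ≈⟨ sym (∏-scale N x g) ⟩
    prod (λ i → x * g i)                                 ≈⟨ Prod.sum-cong-≋ {N} {λ i → x * g i}
                                                              (λ i → scale-nonzeroPart x≉0 (fromFin i)) ⟩
    prod (λ i → nonzeroPart (x * fromFin i) * onlyAtZero x (fromFin i))
                                                         ≈⟨ Prod.∑-distrib-+ (λ i → nonzeroPart (x * fromFin i)) _ ⟩
    prod (λ i → nonzeroPart (x * fromFin i)) * prod (λ i → onlyAtZero x (fromFin i))
                                                         ≈⟨ *-cong (sym scaling-permutes) (∏-onlyAtZero x) ⟩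
    P * x                                                ≈⟨ *-comm P x ⟩
    x * P                                                ∎)
    where
    g : Fin N → Carrier
    g i = nonzeroPart (fromFin i)
    P : Carrier
    P = prod g
    P≉0 : ¬ (P ≈ 0#)
    P≉0 = ∏-nonzero N g (nonzeroPart-nonzero ∘ fromFin)
    x⁻¹ : Carrier
    x⁻¹ = proj₁ (inv x x≉0)
    x⁻¹x≈1 : x⁻¹ * x ≈ 1#
    x⁻¹x≈1 = trans (*-comm x⁻¹ x) (proj₂ (inv x x≉0))
    scaling-permutes : P ≈ prod (λ i → nonzeroPart (x * fromFin i))
    scaling-permutes = sumOverField-bijection *-commutativeMonoid nonzeroPart nonzeroPart-cong
      (x *_) (x⁻¹ *_) *-congˡ *-congˡ
      (λ z → trans (sym (*-assoc x x⁻¹ z)) (trans (*-congʳ (proj₂ (inv x x≉0))) (*-identityˡ z)))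
      (λ z → trans (sym (*-assoc x⁻¹ x z)) (trans (*-congʳ x⁻¹x≈1) (*-identityˡ z)))

  self-inverse : ∀ x → x + x ≈ 0#
  self-inverse x = begin
    x + x               ≈⟨ +-cong (sym (*-identityˡ x)) (sym (*-identityˡ x)) ⟩
    1# * x + 1# * x     ≈⟨ sym (distribʳ x 1# 1#) ⟩
    (1# + 1#) * x       ≈⟨ *-congʳ characteristic-two ⟩
    0# * x              ≈⟨ zeroˡ x ⟩
    0#                  ∎

  drop-double : ∀ a b → a + (b + b) ≈ a
  drop-double a b = trans (+-congˡ (self-inverse b)) (+-identityʳ a)

  sum≈0⇒≈ : ∀ {x y} → x + y ≈ 0# → x ≈ y
  sum≈0⇒≈ {x} {y} x+y≈0 = trans (inverseˡ-unique x y x+y≈0) (sym (inverseʳ-unique y y (self-inverse y)))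

  square-+ : ∀ x y → (x + y) * (x + y) ≈ x * x + y * y
  square-+ x y = begin
    (x + y) * (x + y)               ≈⟨ expand x y ⟩
    (x * x + y * y) + (x * y + x * y) ≈⟨ +-congˡ (self-inverse (x * y)) ⟩
    (x * x + y * y) + 0#            ≈⟨ +-identityʳ _ ⟩
    x * x + y * y                   ∎
    where
    expand : ∀ x y → (x + y) * (x + y) ≈ (x * x + y * y) + (x * y + x * y)
    expand = solve 2 (λ x y → (x :+ y) :* (x :+ y) := (x :* x :+ y :* y) :+ (x :* y :+ x :* y)) refl

  sumTo-cong : ∀ m {f g : ℕ → Carrier} → (∀ i → f i ≈ g i) → sumTo m f ≈ sumTo m g
  sumTo-cong zero    f≈g = refl
  sumTo-cong (suc m) f≈g = +-cong (sumTo-cong m f≈g) (f≈g m)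

  sumTo-+ : ∀ m (f g : ℕ → Carrier) → sumTo m (λ i → f i + g i) ≈ sumTo m f + sumTo m g
  sumTo-+ zero    f g = sym (+-identityʳ 0#)
  sumTo-+ (suc m) f g = trans (+-congʳ (sumTo-+ m f g)) (+-interchange _ _ _ _)

  sumTo-*ʳ : ∀ m (f : ℕ → Carrier) c → sumTo m (λ i → f i * c) ≈ sumTo m f * c
  sumTo-*ʳ zero    f c = sym (zeroˡ c)
  sumTo-*ʳ (suc m) f c = trans (+-congʳ (sumTo-*ʳ m f c)) (sym (distribʳ c _ _))

  sumTo-shift : ∀ m (g : ℕ → Carrier) → sumTo m (g ∘ suc) + g 0 ≈ sumTo m g + g m
  sumTo-shift zero    g = refl
  sumTo-shift (suc m) g = begin
    (sumTo m (g ∘ suc) + g (suc m)) + g 0 ≈⟨ +-swapʳ _ _ _ ⟩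
    (sumTo m (g ∘ suc) + g 0) + g (suc m) ≈⟨ +-congʳ (sumTo-shift m g) ⟩
    (sumTo m g + g m) + g (suc m)         ∎

  sumTo-square : ∀ m (f : ℕ → Carrier) → sumTo m f * sumTo m f ≈ sumTo m (λ i → f i * f i)
  sumTo-square zero    f = zeroˡ 0#
  sumTo-square (suc m) f = trans (square-+ _ _) (+-congʳ (sumTo-square m f))

  frob : ℕ → Carrier → Carrier
  frob i x = pow x (2 ℕ.^ i)

  frob-suc : ∀ i x → frob (suc i) x ≈ frob i x * frob i x
  frob-suc i x = trans (pow-+ x (2 ℕ.^ i) _) (*-congˡ (trans (pow-+ x (2 ℕ.^ i) 0) (*-identityʳ _)))

  frob-+ : ∀ i x y → frob i (x + y) ≈ frob i x + frob i y
  frob-+ zero    x y = trans (*-identityʳ _) (+-cong (sym (*-identityʳ x)) (sym (*-identityʳ y)))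
  frob-+ (suc i) x y = begin
    frob (suc i) (x + y)                      ≈⟨ frob-suc i (x + y) ⟩
    frob i (x + y) * frob i (x + y)           ≈⟨ *-cong (frob-+ i x y) (frob-+ i x y) ⟩
    (frob i x + frob i y) * (frob i x + frob i y) ≈⟨ square-+ _ _ ⟩
    frob i x * frob i x + frob i y * frob i y ≈⟨ +-cong (sym (frob-suc i x)) (sym (frob-suc i y)) ⟩
    frob (suc i) x + frob (suc i) y           ∎

  frob-idempotent : ∀ {c} i → c * c ≈ c → frob i c ≈ c
  frob-idempotent zero    cc≈c = *-identityʳ _
  frob-idempotent (suc i) cc≈c =
    trans (frob-suc i _) (trans (*-cong (frob-idempotent i cc≈c) (frob-idempotent i cc≈c)) cc≈c)

  Tr-cong : ∀ {x y} → x ≈ y → Tr x ≈ Tr y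
  Tr-cong e = sumTo-cong n (λ i → pow-cong (2 ℕ.^ i) e)

  Tr-+ : ∀ x y → Tr (x + y) ≈ Tr x + Tr y
  Tr-+ x y = trans (sumTo-cong n (λ i → frob-+ i x y)) (sumTo-+ n _ _)

  -- Tr is linear over the prime field {c | c² = c}.
  Tr-scale : ∀ x {c} → c * c ≈ c → Tr (x * c) ≈ Tr x * c
  Tr-scale x {c} cc≈c = trans (sumTo-cong n (λ i → trans (pow-* x c (2 ℕ.^ i)) (*-congˡ (frob-idempotent i cc≈c))))
                              (sumTo-*ʳ n (λ i → frob i x) c)

  Tr-zero : Tr 0# ≈ 0#
  Tr-zero = trans (Tr-cong (sym (zeroʳ 0#))) (trans (Tr-scale 0# (zeroʳ 0#)) (zeroʳ _))

  -- Tr x² = Tr x, using x^(2^n) = x; hence Tr takes values in {0, 1}.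
  Tr-idempotent : ∀ x → Tr x * Tr x ≈ Tr x
  Tr-idempotent x = ∙-cancelʳ x _ _ (begin
    Tr x * Tr x + x                         ≈⟨ +-cong (sumTo-square n (λ i → frob i x)) (sym (*-identityʳ x)) ⟩
    sumTo n (λ i → frob i x * frob i x) + frob 0 x ≈⟨ +-congʳ (sumTo-cong n (λ i → sym (frob-suc i x))) ⟩
    sumTo n (λ i → frob (suc i) x) + frob 0 x ≈⟨ sumTo-shift n (λ i → frob i x) ⟩
    Tr x + pow x N                          ≈⟨ +-congˡ (frobenius x) ⟩
    Tr x + x                                ∎)

  Tr-0or1 : ∀ x → Tr x ≈ 0# ⊎ Tr x ≈ 1#
  Tr-0or1 x = idempotent-0or1 (Tr x) (Tr-idempotent x)

  -- The trace is a polynomial of degree 2^(n-1) < 2^n, so it does not vanish on all of K.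
  open Polynomial commRing using (eval; eval-constant; lastOr; leading)
  open Polynomial.RootBound commRing no-zero-divisors using (root-bound)

  addMonomial : ℕ → List Carrier → List Carrier
  addMonomial zero    []       = 1# ∷ []
  addMonomial zero    (a ∷ as) = (a + 1#) ∷ as
  addMonomial (suc k) []       = 0# ∷ addMonomial k []
  addMonomial (suc k) (a ∷ as) = a ∷ addMonomial k as

  eval-addMonomial : ∀ k as x → eval (addMonomial k as) x ≈ eval as x + pow x k
  eval-addMonomial zero [] x =
    trans (eval-constant 1# x) (sym (+-identityˡ 1#))
  eval-addMonomial zero (a ∷ as) x = +-swapʳ a 1# (x * eval as x)
  eval-addMonomial (suc k) [] x =
    +-congˡ (*-congˡ (trans (eval-addMonomial k [] x) (+-identityˡ _)))
  eval-addMonomial (suc k) (a ∷ as) x = begin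
    a + x * eval (addMonomial k as) x   ≈⟨ +-congˡ (*-congˡ (eval-addMonomial k as x)) ⟩
    a + x * (eval as x + pow x k)       ≈⟨ +-congˡ (distribˡ x _ _) ⟩
    a + (x * eval as x + x * pow x k)   ≈⟨ sym (+-assoc _ _ _) ⟩
    (a + x * eval as x) + x * pow x k   ∎

  length-addMonomial : ∀ k as → length as ≤ k → length (addMonomial k as) ≡ suc k
  length-addMonomial zero    []       _         = ≡.refl
  length-addMonomial (suc k) []       _         = ≡.cong suc (length-addMonomial k [] z≤n)
  length-addMonomial (suc k) (a ∷ as) (s≤s len) = ≡.cong suc (length-addMonomial k as len)

  lastOr-addMonomial : ∀ k as d → length as ≤ k → lastOr d (addMonomial k as) ≡ 1#
  lastOr-addMonomial zero    []       d _         = ≡.refl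
  lastOr-addMonomial (suc k) []       d _         = lastOr-addMonomial k [] 0# z≤n
  lastOr-addMonomial (suc k) (a ∷ as) d (s≤s len) = lastOr-addMonomial k as a len

  traceCoefficients : ℕ → List Carrier
  traceCoefficients zero    = []
  traceCoefficients (suc m) = addMonomial (2 ℕ.^ m) (traceCoefficients m)

  eval-traceCoefficients : ∀ m x → eval (traceCoefficients m) x ≈ sumTo m (λ i → frob i x)
  eval-traceCoefficients zero    x = refl
  eval-traceCoefficients (suc m) x =
    trans (eval-addMonomial (2 ℕ.^ m) _ x) (+-congʳ (eval-traceCoefficients m x))

  length-traceCoefficients : ∀ m → length (traceCoefficients m) ≤ 2 ℕ.^ m
  length-traceCoefficients zero    = z≤n
  length-traceCoefficients (suc m) = ℕP.≤-trans
    (ℕP.≤-reflexive (length-addMonomial (2 ℕ.^ m) _ (length-traceCoefficients m)))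
    (ℕP.^-monoʳ-< 2 (s≤s (s≤s z≤n)) (ℕP.n<1+n m))

  leading-traceCoefficients : ∀ m → 1 ≤ m → leading (traceCoefficients m) ≡ 1#
  leading-traceCoefficients (suc m) _ =
    lastOr-addMonomial (2 ℕ.^ m) _ 0# (length-traceCoefficients m)

  element-of-trace-one : 1 ≤ n → ∃ λ w → Tr w ≈ 1#
  element-of-trace-one 1≤n with FinP.¬∀⟶∃¬ N (λ i → Tr (fromFin i) ≈ 0#) (λ i → Tr (fromFin i) ≟ 0#) not-all-roots
    where
    not-all-roots : ¬ (∀ i → Tr (fromFin i) ≈ 0#)
    not-all-roots roots = root-bound N fromFin fromFin-injective (traceCoefficients n)
      (length-traceCoefficients n)
      (λ lead≈0 → 0≉1 (trans (sym lead≈0) (reflexive (leading-traceCoefficients n 1≤n))))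
      (λ i → trans (eval-traceCoefficients n (fromFin i)) (roots i))
  ... | i , Tr≉0 with Tr-0or1 (fromFin i)
  ...   | inj₁ Tr≈0 = ⊥-elim (Tr≉0 Tr≈0)
  ...   | inj₂ Tr≈1 = fromFin i , Tr≈1

  e₂ : ℕ → (ℕ → Carrier) → Carrier
  e₂ m a = sumTo m (λ j → sumTo j (λ i → a i * a j))

  e₂-cong : ∀ m {a b : ℕ → Carrier} → (∀ i → a i ≈ b i) → e₂ m a ≈ e₂ m b
  e₂-cong m a≈b = sumTo-cong m (λ j → sumTo-cong j (λ i → *-cong (a≈b i) (a≈b j)))

  polarization : ∀ m (a b : ℕ → Carrier) →
    e₂ m (λ i → a i + b i) + (e₂ m a + e₂ m b) ≈ sumTo m a * sumTo m b + sumTo m (λ i → a i * b i)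
  polarization zero    a b = trans (trans (+-identityˡ _) (+-identityʳ 0#)) (sym (trans (+-identityʳ _) (zeroˡ 0#)))
  polarization (suc m) a b = begin
    (Z + sumTo m (λ i → (a i + b i) * (α + β))) + ((X + sumTo m (λ i → a i * α)) + (Y + sumTo m (λ i → b i * β)))
      ≈⟨ +-cong (+-congˡ (trans (sumTo-*ʳ m _ (α + β)) (*-congʳ (sumTo-+ m a b))))
                (+-cong (+-congˡ (sumTo-*ʳ m a α)) (+-congˡ (sumTo-*ʳ m b β))) ⟩
    (Z + (A + B) * (α + β)) + ((X + A * α) + (Y + B * β))
      ≈⟨ expandˡ Z X Y A B α β ⟩
    (((Z + (X + Y)) + (A * β + α * B)) + (A * α + A * α)) + (B * β + B * β)
      ≈⟨ trans (drop-double _ _) (drop-double _ _) ⟩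
    (Z + (X + Y)) + (A * β + α * B)
      ≈⟨ +-congʳ (polarization m a b) ⟩
    (A * B + D) + (A * β + α * B)
      ≈⟨ sym (drop-double _ _) ⟩
    ((A * B + D) + (A * β + α * B)) + (α * β + α * β)
      ≈⟨ expandʳ A B D α β ⟩
    (A + α) * (B + β) + (D + α * β)
      ∎
    where
    α β A B D X Y Z : Carrier
    α = a m
    β = b m
    A = sumTo m a
    B = sumTo m b
    D = sumTo m (λ i → a i * b i)
    X = e₂ m a
    Y = e₂ m b
    Z = e₂ m (λ i → a i + b i)
    expandˡ : ∀ Z X Y A B α β →
      (Z + (A + B) * (α + β)) + ((X + A * α) + (Y + B * β)) ≈
      (((Z + (X + Y)) + (A * β + α * B)) + (A * α + A * α)) + (B * β + B * β)
    expandˡ = solve 7 (λ Z X Y A B α β →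
      (Z :+ (A :+ B) :* (α :+ β)) :+ ((X :+ A :* α) :+ (Y :+ B :* β)) :=
      (((Z :+ (X :+ Y)) :+ (A :* β :+ α :* B)) :+ (A :* α :+ A :* α)) :+ (B :* β :+ B :* β)) refl
    expandʳ : ∀ A B D α β →
      ((A * B + D) + (A * β + α * B)) + (α * β + α * β) ≈ (A + α) * (B + β) + (D + α * β)
    expandʳ = solve 5 (λ A B D α β →
      ((A :* B :+ D) :+ (A :* β :+ α :* B)) :+ (α :* β :+ α :* β) := (A :+ α) :* (B :+ β) :+ (D :+ α :* β)) refl

  Q-as-e₂ : ∀ x → Q x ≈ e₂ n (λ i → frob i x)
  Q-as-e₂ x = sumTo-cong n (λ j → sumTo-cong j (λ i → pow-+ x (2 ℕ.^ i) (2 ℕ.^ j)))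

  Q-cong : ∀ {x y} → x ≈ y → Q x ≈ Q y
  Q-cong e = sumTo-cong n (λ j → sumTo-cong j (λ i → pow-cong (2 ℕ.^ i ℕ.+ 2 ℕ.^ j) e))

  BQ-formula : ∀ x y → BQ x y ≈ Tr x * Tr y + Tr (x * y)
  BQ-formula x y = begin
    (Q x + Q y) + Q (x + y)
      ≈⟨ +-cong (+-cong (Q-as-e₂ x) (Q-as-e₂ y)) (trans (Q-as-e₂ (x + y)) (e₂-cong n (λ i → frob-+ i x y))) ⟩
    (e₂ n a + e₂ n b) + e₂ n (λ i → a i + b i) ≈⟨ +-comm _ _ ⟩
    e₂ n (λ i → a i + b i) + (e₂ n a + e₂ n b) ≈⟨ polarization n a b ⟩
    Tr x * Tr y + sumTo n (λ i → a i * b i)    ≈⟨ +-congˡ (sumTo-cong n (λ i → sym (pow-* x y (2 ℕ.^ i)))) ⟩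
    Tr x * Tr y + Tr (x * y)                   ∎
    where
    a b : ℕ → Carrier
    a i = frob i x
    b i = frob i y

  Q-zero : Q 0# ≈ 0#
  Q-zero = begin
    Q 0#                          ≈⟨ sym (+-identityˡ _) ⟩
    0# + Q 0#                     ≈⟨ +-cong (sym (self-inverse (Q 0#))) (Q-cong (sym (+-identityʳ 0#))) ⟩
    BQ 0# 0#                      ≈⟨ BQ-formula 0# 0# ⟩
    Tr 0# * Tr 0# + Tr (0# * 0#)  ≈⟨ +-cong (trans (*-congʳ Tr-zero) (zeroˡ _)) (trans (Tr-cong (zeroʳ 0#)) Tr-zero) ⟩
    0# + 0#                       ≈⟨ +-identityʳ 0# ⟩
    0#                            ∎

  -- Tr 1 and Q 1 are the images in K of n and of (n choose 2).
  count : ℕ → Carrier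
  count m = sumTo m (λ _ → 1#)

  pairs : ℕ → Carrier
  pairs m = sumTo m count

  Tr-one : Tr 1# ≈ count n
  Tr-one = sumTo-cong n (λ i → pow-one (2 ℕ.^ i))

  Q-one : Q 1# ≈ pairs n
  Q-one = sumTo-cong n (λ j → sumTo-cong j (λ i → pow-one (2 ℕ.^ i ℕ.+ 2 ℕ.^ j)))

  count-period : ∀ m → count (2 ℕ.+ m) ≈ count m
  count-period m = trans (+-assoc _ _ _) (drop-double (count m) 1#)

  pairs-period : ∀ m → pairs (4 ℕ.+ m) ≈ pairs m
  pairs-period m = begin
    (((pairs m + count m) + count (1 ℕ.+ m)) + count (2 ℕ.+ m)) + count (3 ℕ.+ m)
      ≈⟨ +-cong (+-congˡ (count-period m)) (count-period (1 ℕ.+ m)) ⟩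
    (((pairs m + count m) + count (1 ℕ.+ m)) + count m) + count (1 ℕ.+ m)
      ≈⟨ regroup (pairs m) (count m) (count (1 ℕ.+ m)) ⟩
    (pairs m + (count m + count m)) + (count (1 ℕ.+ m) + count (1 ℕ.+ m))
      ≈⟨ trans (drop-double _ _) (drop-double _ _) ⟩
    pairs m ∎
    where
    regroup : ∀ p a b → (((p + a) + b) + a) + b ≈ (p + (a + a)) + (b + b)
    regroup = solve 3 (λ p a b → (((p :+ a) :+ b) :+ a) :+ b := (p :+ (a :+ a)) :+ (b :+ b)) refl

  vanishing-at-multiples : ∀ q → count (q ℕ.* 4) ≈ 0# × pairs (q ℕ.* 4) ≈ 0#
  vanishing-at-multiples zero    = refl , refl
  vanishing-at-multiples (suc q) =
    trans (count-period (2 ℕ.+ q ℕ.* 4)) (trans (count-period (q ℕ.* 4)) (proj₁ vanishing)) ,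
    trans (pairs-period (q ℕ.* 4)) (proj₂ vanishing)
    where
    vanishing : count (q ℕ.* 4) ≈ 0# × pairs (q ℕ.* 4) ≈ 0#
    vanishing = vanishing-at-multiples q

  vanishing-if-divisible : ∀ {m} → 4 ∣ m → count m ≈ 0# × pairs m ≈ 0#
  vanishing-if-divisible (divides q ≡.refl) = vanishing-at-multiples q

  divisible-if-vanishing : ∀ m → count m ≈ 0# → pairs m ≈ 0# → 4 ∣ m
  divisible-if-vanishing 0 _ _ = divides 0 ≡.refl
  divisible-if-vanishing 1 count≈0 _ = ⊥-elim (0≉1 (trans (sym count≈0) (+-identityˡ 1#)))
  divisible-if-vanishing 2 _ pairs≈0 = ⊥-elim (0≉1 (trans (sym pairs≈0)
    (trans (+-cong (+-identityʳ 0#) (+-identityˡ 1#)) (+-identityˡ 1#))))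
  divisible-if-vanishing 3 count≈0 _ = ⊥-elim (0≉1 (trans (sym count≈0)
    (trans (count-period 1) (+-identityˡ 1#))))
  divisible-if-vanishing (suc (suc (suc (suc m)))) count≈0 pairs≈0 =
    ∣m∣n⇒∣m+n ∣-refl (divisible-if-vanishing m
      (trans (sym (trans (count-period (2 ℕ.+ m)) (count-period m))) count≈0)
      (trans (sym (pairs-period m)) pairs≈0))

  -- For x ∈ H the form B_Q(x, y) reduces to Tr (x y); hence membership in the radical.
  radical-criterion : ∀ {y} → InH y → (∀ x → InH x → Tr (x * y) ≈ 0#) → Q y ≈ 0# → InRadQH y
  radical-criterion {y} Tr-y orth Q-y = Tr-y , BQ-vanishes , Q-y
    where
    BQ-vanishes : ∀ x → InH x → BQ x y ≈ 0#
    BQ-vanishes x Tr-x = trans (BQ-formula x y)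
      (trans (+-cong (trans (*-congʳ Tr-x) (zeroˡ _)) (orth x Tr-x)) (+-identityʳ 0#))

  radical-orthogonal : ∀ {y} → InRadQH y → ∀ x → InH x → Tr (x * y) ≈ 0#
  radical-orthogonal {y} (_ , BQ-vanishes , _) x Tr-x = begin
    Tr (x * y)                ≈⟨ sym (+-identityˡ _) ⟩
    0# + Tr (x * y)           ≈⟨ +-congʳ (sym (trans (*-congʳ Tr-x) (zeroˡ _))) ⟩
    Tr x * Tr y + Tr (x * y)  ≈⟨ sym (BQ-formula x y) ⟩
    BQ x y                    ≈⟨ BQ-vanishes x Tr-x ⟩
    0#                        ∎

  zero-in-radical : ∀ {y} → y ≈ 0# → InRadQH y
  zero-in-radical y≈0 = radical-criterion
    (trans (Tr-cong y≈0) Tr-zero)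
    (λ x _ → trans (Tr-cong (trans (*-congˡ y≈0) (zeroʳ x))) Tr-zero)
    (trans (Q-cong y≈0) Q-zero)

  one-in-radical : 4 ∣ n → ∀ {y} → y ≈ 1# → InRadQH y
  one-in-radical 4∣n y≈1 = radical-criterion
    (trans (Tr-cong y≈1) (trans Tr-one (proj₁ vanishing)))
    (λ x Tr-x → trans (Tr-cong (trans (*-congˡ y≈1) (*-identityʳ x))) Tr-x)
    (trans (Q-cong y≈1) (trans Q-one (proj₂ vanishing)))
    where
    vanishing : count n ≈ 0# × pairs n ≈ 0#
    vanishing = vanishing-if-divisible 4∣n

  one-in-radical⇒4∣n : ∀ {y} → InRadQH y → y ≈ 1# → 4 ∣ n
  one-in-radical⇒4∣n (Tr-y , _ , Q-y) y≈1 = divisible-if-vanishing n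
    (trans (sym Tr-one) (trans (Tr-cong (sym y≈1)) Tr-y))
    (trans (sym Q-one) (trans (Q-cong (sym y≈1)) Q-y))

  module TraceOne (w : Carrier) (Tr-w≈1 : Tr w ≈ 1#) where

    trace-form-nondegenerate : ∀ z → (∀ x → Tr (x * z) ≈ 0#) → z ≈ 0#
    trace-form-nondegenerate z orth with z ≟ 0#
    ... | yes z≈0 = z≈0
    ... | no z≉0 = ⊥-elim (0≉1 (begin
      0#                  ≈⟨ sym (orth (w * z⁻¹)) ⟩
      Tr ((w * z⁻¹) * z)  ≈⟨ Tr-cong (trans (*-assoc w z⁻¹ z) (trans (*-congˡ z⁻¹z≈1) (*-identityʳ w))) ⟩
      Tr w                ≈⟨ Tr-w≈1 ⟩
      1#                  ∎))
      where
      z⁻¹ : Carrier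
      z⁻¹ = proj₁ (inv z z≉0)
      z⁻¹z≈1 : z⁻¹ * z ≈ 1#
      z⁻¹z≈1 = trans (*-comm z⁻¹ z) (proj₂ (inv z z≉0))

    orthogonal-factor : ∀ {y} → (∀ x → InH x → Tr (x * y) ≈ 0#) → ∀ x → Tr (x * y) ≈ Tr x * Tr (w * y)
    orthogonal-factor {y} orth x with Tr-0or1 x
    ... | inj₁ Tr-x≈0 = trans (orth x Tr-x≈0) (sym (trans (*-congʳ Tr-x≈0) (zeroˡ _)))
    ... | inj₂ Tr-x≈1 = trans (sum≈0⇒≈ (begin
      Tr (x * y) + Tr (w * y)  ≈⟨ sym (Tr-+ _ _) ⟩
      Tr (x * y + w * y)       ≈⟨ Tr-cong (sym (distribʳ y x w)) ⟩
      Tr ((x + w) * y)         ≈⟨ orth (x + w) x+w∈H ⟩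
      0#                       ∎)) (sym (trans (*-congʳ Tr-x≈1) (*-identityˡ _)))
      where
      x+w∈H : Tr (x + w) ≈ 0#
      x+w∈H = trans (Tr-+ x w) (trans (+-cong Tr-x≈1 Tr-w≈1) characteristic-two)

    orthogonal-complement-of-H : ∀ y → (∀ x → InH x → Tr (x * y) ≈ 0#) → y ≈ 0# ⊎ y ≈ 1#
    orthogonal-complement-of-H y orth = map-⊎ (trans y≈t) (trans y≈t) (Tr-0or1 (w * y))
      where
      t : Carrier
      t = Tr (w * y)
      y≈t : y ≈ t
      y≈t = sum≈0⇒≈ (trace-form-nondegenerate (y + t) (λ x → begin
        Tr (x * (y + t))          ≈⟨ Tr-cong (distribˡ x y t) ⟩
        Tr (x * y + x * t)        ≈⟨ Tr-+ _ _ ⟩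
        Tr (x * y) + Tr (x * t)   ≈⟨ +-cong (orthogonal-factor orth x) (Tr-scale x (Tr-idempotent (w * y))) ⟩
        Tr x * t + Tr x * t       ≈⟨ self-inverse _ ⟩
        0#                        ∎))

  radical-⊆-01 : 1 ≤ n → ∀ y → InRadQH y → y ≈ 0# ⊎ y ≈ 1#
  radical-⊆-01 1≤n y y∈rad =
    TraceOne.orthogonal-complement-of-H w Tr-w≈1 y (radical-orthogonal y∈rad)
    where
    w : Carrier
    w = proj₁ (element-of-trace-one 1≤n)
    Tr-w≈1 : Tr w ≈ 1#
    Tr-w≈1 = proj₂ (element-of-trace-one 1≤n)

lemma1 : {c ℓ : Level} (n : ℕ) → 1 ≤ n → (K : FiniteField2 n c ℓ) →
    let open FiniteField2 K in
    let open FieldOps K in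
    (4 ∣ n → ∀ y → InRadQH y ⇔ (y ≈ 0# ⊎ y ≈ 1#)) ×
    (¬ (4 ∣ n) → ∀ y → InRadQH y ⇔ (y ≈ 0#))
lemma1 n 1≤n K = divisible , not-divisible
  where
  open FiniteField2 K
  open FieldOps K
  open FiniteFieldTheory K
  divisible : 4 ∣ n → ∀ y → InRadQH y ⇔ (y ≈ 0# ⊎ y ≈ 1#)
  divisible 4∣n y = mk⇔ (radical-⊆-01 1≤n y) [ zero-in-radical , one-in-radical 4∣n ]′
  not-divisible : ¬ (4 ∣ n) → ∀ y → InRadQH y ⇔ (y ≈ 0#)
  not-divisible 4∤n y = mk⇔ only-zero zero-in-radical
    where
    only-zero : InRadQH y → y ≈ 0#
    only-zero y∈rad = [ (λ y≈0 → y≈0) , (λ y≈1 → ⊥-elim (4∤n (one-in-radical⇒4∣n y∈rad y≈1))) ]′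
                        (radical-⊆-01 1≤n y y∈rad)
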